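{- Let $p$ be a prime. Then $\Gamma'\mathbf e_3=\mathbb Z_p^4\setminus P_1\mathbb Z_p^4$, $\Gamma'\mathbf e_2=P_1\mathbb Z_p^4\setminus P_3\mathbb Z_p^4$, $\Gamma'\mathbf e_1=P_3\mathbb Z_p^4\setminus p\mathbb Z_p^4$, $\Gamma^A\mathbf e_3=\mathbb Z_p^4\setminus A\mathbb Z_p^4$, $\Gamma^A\mathbf e_1=A\mathbb Z_p^4\setminus p\mathbb Z_p^4$, where $H\mathbf v=\{X\mathbf v:X\in H\}$.
   Context: $J=\begin{pmatrix}0&E_2\\-E_2&0\end{pmatrix}$, $\Gamma=GSp_4(\mathbb Z_p)=\{g\in GL_4(\mathbb Z_p):{}^tgJg=\mu(g)J,\ \mu(g)\in\mathbb Z_p^\times\}$. $\mathbf e_1,\mathbf e_2,\mathbf e_3$ are the first three standard basis column vectors of $\mathbb Z_p^4$. $P_1=\mathrm{diag}(1,1,p,1)$, $P_3=\mathrm{diag}(1,p,p,p)$, $A=\mathrm{diag}(1,1,p,p)$. $\Gamma^A=\Gamma\cap A\Gamma A^{ -1}$, which is the set of $X\in\Gamma$ whose entries $X_{31},X_{32},X_{41},X_{42}$ lie in $p\mathbb Z_p$. $\Gamma'$ is the set of $X\in\Gamma$ whose entries $X_{21},X_{31},X_{41},X_{32},X_{34}$ lie in $p\mathbb Z_p$. -}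

module Defs where

open import Data.Nat as ℕ using (ℕ; suc; _^_)
open import Data.Integer as ℤ using (ℤ; +_; _-_)
open import Data.Integer.Divisibility.Signed as D using (_∣_)
open import Data.Integer.Properties as ℤP using ()
open import Data.Integer.Tactic.RingSolver using (solve-∀)
open import Data.Fin using (Fin; zero; suc)
open import Data.Product using (Σ; ∃; _×_; _,_)
open import Relation.Binary.PropositionalEquality using (_≡_; refl; subst; sym)
open import Relation.Nullary using (¬_)

-- The p-adic integers ℤ_p, realised as (classes of) coherent sequences
-- of integers f : ℕ → ℤ with p^n ∣ f(n+1) - f(n); the element they
-- represent is the p-adic limit of (f n).

record ℤp (p : ℕ) : Set where
  constructor mkℤp
  field
    seq : ℕ → ℤ
    coh : ∀ n → (+ (p ^ n)) ∣ (seq (suc n) - seq n)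
open ℤp public

module _ {p : ℕ} where

  infix 4 _≈_
  _≈_ : ℤp p → ℤp p → Set
  x ≈ y = ∀ n → (+ (p ^ n)) ∣ (seq x n - seq y n)

  private
    diff0 : ∀ c → c - c ≡ + 0
    diff0 c = ℤP.+-inverseʳ c
    ∣0 : ∀ k → k ∣ + 0
    ∣0 k = D.divides (+ 0) refl

  ι : ℤ → ℤp p
  ι c = mkℤp (λ _ → c) (λ n → subst (_ ∣_) (sym (diff0 c)) (∣0 _))

  0ₚ 1ₚ : ℤp p
  0ₚ = ι (+ 0)
  1ₚ = ι (+ 1)

  infixl 6 _⊕_
  infixl 7 _⊗_

  _⊕_ : ℤp p → ℤp p → ℤp p
  x ⊕ y = mkℤp (λ n → seq x n ℤ.+ seq y n) λ n →
    subst (_ ∣_) (eq (seq x (suc n)) (seq x n) (seq y (suc n)) (seq y n))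
      (D.∣m∣n⇒∣m+n (coh x n) (coh y n))
    where
    eq : ∀ a b c d → (a - b) ℤ.+ (c - d) ≡ (a ℤ.+ c) - (b ℤ.+ d)
    eq = solve-∀

  ⊖_ : ℤp p → ℤp p
  ⊖ x = mkℤp (λ n → ℤ.- seq x n) λ n →
    subst (_ ∣_) (eq (seq x (suc n)) (seq x n)) (D.∣m⇒∣-m (coh x n))
    where
    eq : ∀ a b → ℤ.- (a - b) ≡ (ℤ.- a) - (ℤ.- b)
    eq = solve-∀

  _⊗_ : ℤp p → ℤp p → ℤp p
  x ⊗ y = mkℤp (λ n → seq x n ℤ.* seq y n) λ n →
    subst (_ ∣_) (eq (seq x (suc n)) (seq x n) (seq y (suc n)) (seq y n))
      (D.∣m∣n⇒∣m+n (D.∣n⇒∣m*n (seq x (suc n)) (coh y n))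
                   (D.∣m⇒∣m*n (seq y n) (coh x n)))
    where
    eq : ∀ a b c d → a ℤ.* (c - d) ℤ.+ (a - b) ℤ.* d ≡ a ℤ.* c - b ℤ.* d
    eq = solve-∀

  IsUnit : ℤp p → Set
  IsUnit x = ∃ λ y → x ⊗ y ≈ 1ₚ

  InPZp : ℤp p → Set
  InPZp x = ∃ λ y → x ≈ ι (+ p) ⊗ y

  Vec4 : Set
  Vec4 = Fin 4 → ℤp p

  Mat4 : Set
  Mat4 = Fin 4 → Fin 4 → ℤp p

  sum4 : (Fin 4 → ℤp p) → ℤp p
  sum4 f = f zero ⊕ f (suc zero) ⊕ f (suc (suc zero)) ⊕ f (suc (suc (suc zero)))

  infix 4 _≈ᵥ_ _≈ₘ_
  _≈ᵥ_ : Vec4 → Vec4 → Set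
  v ≈ᵥ w = ∀ i → v i ≈ w i

  _≈ₘ_ : Mat4 → Mat4 → Set
  M ≈ₘ N = ∀ i j → M i j ≈ N i j

  _·ₘ_ : Mat4 → Mat4 → Mat4
  (M ·ₘ N) i j = sum4 λ k → M i k ⊗ N k j

  _·ᵥ_ : Mat4 → Vec4 → Vec4
  (M ·ᵥ v) i = sum4 λ k → M i k ⊗ v k

  transpose : Mat4 → Mat4
  transpose M i j = M j i

  _•ₘ_ : ℤp p → Mat4 → Mat4
  (c •ₘ M) i j = c ⊗ M i j

  _•ᵥ_ : ℤp p → Vec4 → Vec4
  (c •ᵥ v) i = c ⊗ v i

  idM : Mat4
  idM i j with i Data.Fin.≟ j
  ... | Relation.Nullary.yes _ = 1ₚ
  ... | Relation.Nullary.no _ = 0ₚ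

  diag : ℤp p → ℤp p → ℤp p → ℤp p → Mat4
  diag a b c d zero zero = a
  diag a b c d (suc zero) (suc zero) = b
  diag a b c d (suc (suc zero)) (suc (suc zero)) = c
  diag a b c d (suc (suc (suc zero))) (suc (suc (suc zero))) = d
  diag a b c d _ _ = 0ₚ

  J : Mat4
  J zero (suc (suc zero)) = 1ₚ
  J (suc zero) (suc (suc (suc zero))) = 1ₚ
  J (suc (suc zero)) zero = ι (ℤ.- + 1)
  J (suc (suc (suc zero))) (suc zero) = ι (ℤ.- + 1)
  J _ _ = 0ₚ

  e : Fin 4 → Vec4
  e i j = idM j i

  pₚ : ℤp p
  pₚ = ι (+ p)

  P₁ P₃ A : Mat4
  P₁ = diag 1ₚ 1ₚ pₚ 1ₚ
  P₃ = diag 1ₚ pₚ pₚ pₚ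
  A  = diag 1ₚ 1ₚ pₚ pₚ

  InGL4 : Mat4 → Set
  InGL4 X = ∃ λ Y → (X ·ₘ Y ≈ₘ idM) × (Y ·ₘ X ≈ₘ idM)

  InΓ : Mat4 → Set
  InΓ g = InGL4 g × ∃ λ μ → IsUnit μ × (transpose g ·ₘ (J ·ₘ g) ≈ₘ μ •ₘ J)

  private
    #0 #1 #2 #3 : Fin 4
    #0 = zero
    #1 = suc zero
    #2 = suc (suc zero)
    #3 = suc (suc (suc zero))

  -- Γ^A : entries X₃₁, X₃₂, X₄₁, X₄₂ in pℤ_p (1-based indices)
  InΓA : Mat4 → Set
  InΓA X = InΓ X × InPZp (X #2 #0) × InPZp (X #2 #1)
                 × InPZp (X #3 #0) × InPZp (X #3 #1)

  -- Γ' : entries X₂₁, X₃₁, X₄₁, X₃₂, X₃₄ in pℤ_p (1-based indices)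
  InΓ' : Mat4 → Set
  InΓ' X = InΓ X × InPZp (X #1 #0) × InPZp (X #2 #0) × InPZp (X #3 #0)
                 × InPZp (X #2 #1) × InPZp (X #2 #3)

  InOrbit : (Mat4 → Set) → Vec4 → Vec4 → Set
  InOrbit H v w = ∃ λ X → H X × (X ·ᵥ v ≈ᵥ w)

  InImage : Mat4 → Vec4 → Set
  InImage M w = ∃ λ u → M ·ᵥ u ≈ᵥ w

  InPZp4 : Vec4 → Set
  InPZp4 w = ∃ λ u → pₚ •ᵥ u ≈ᵥ w

{-# OPTIONS --safe #-}
module Submission where

-- Sufficiency: every vector w of the claimed set has a coordinate wₘ that is a
-- p-adic unit, and an explicit matrix with entries 0 or ±wᵢ has w as the
-- required column, satisfies the congruences defining Γ' or Γᴬ, and is a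
-- symplectic similitude with multiplier wₘ²; the last fact is a polynomial
-- identity in the wᵢ, checked by normalisation.  Necessity: an element of Γ
-- is invertible modulo p, so no row or column of it vanishes mod p and, by
-- the Cauchy–Binet formula for 2×2 minors, no two rows (or columns) are
-- supported on a single coordinate mod p.  When w lies outside the claimed
-- set, the congruences defining Γ' or Γᴬ force one of these degeneracies.

open import Defs
open import Data.Nat using (ℕ)
open import Data.Nat.Primality using (Prime)
open import Data.Fin using (zero; suc)
open import Data.Product using (_×_)
open import Relation.Nullary using (¬_)
open import Function.Bundles using (_⇔_)

open import Data.Nat as ℕ using (_^_; NonZero)
import Data.Nat.Properties as ℕP
import Data.Nat.Divisibility as ℕD
open import Data.Nat.Base using (nonTrivial⇒n>1)
open import Data.Nat.Coprimality using (Coprime; coprime-Bézout; coprime-divisor)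
open import Data.Nat.GCD using (module Bézout)
open import Data.Nat.Primality using (prime⇒irreducible; prime⇒nonZero; prime⇒nonTrivial)
open import Data.Integer as ℤ using (ℤ; +_; _+_; _*_; _-_; -_)
import Data.Integer.Properties as ℤP
open import Data.Integer.Divisibility.Signed as D using (_∣_; divides; _∣?_)
open import Data.Integer.Tactic.RingSolver using (solve-∀)
open import Data.Integer.Solver using (module +-*-Solver)
open +-*-Solver using
  (Polynomial; op; [+]; [*]; con; var; _:^_; :-_; _:+_; _:*_; _:-_;
   ⟦_⟧; normalise; _≈N_; _≟N_; ⟦_⟧N-cong; prove)
open import Data.Fin using (Fin; #_; _≟_; _↑ˡ_; _↑ʳ_)
open import Data.Vec as Vec using (Vec; []; _∷_; lookup; tabulate; _++_)
open import Data.Vec.Properties using (lookup-map; lookup∘tabulate)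
open import Data.Maybe as Maybe using (Maybe; from-just)
open import Data.Product using (∃; _,_; _,′_; proj₁; proj₂)
open import Data.Sum using (inj₁; inj₂)
open import Data.Empty using (⊥-elim)
open import Relation.Nullary using (Dec; yes; no)
open import Relation.Nullary.Decidable using (map′)
open import Relation.Nullary.Negation using (contradiction)
open import Relation.Binary.PropositionalEquality
  using (_≡_; _≢_; refl; sym; trans; cong; cong₂; subst; subst₂; module ≡-Reasoning)
open import Relation.Binary.Bundles using (Setoid)
import Relation.Binary.Reasoning.Setoid as SetoidReasoning
open import Function.Base using (_∘_; case_of_)
open import Function.Bundles using (mk⇔; module Equivalence)

open Equivalence using (to; from)

∀-Fin4 : ∀ {a} {P : Fin 4 → Set a} →
         P (# 0) → P (# 1) → P (# 2) → P (# 3) → ∀ i → P i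
∀-Fin4 p₀ p₁ p₂ p₃ zero                   = p₀
∀-Fin4 p₀ p₁ p₂ p₃ (suc zero)             = p₁
∀-Fin4 p₀ p₁ p₂ p₃ (suc (suc zero))       = p₂
∀-Fin4 p₀ p₁ p₂ p₃ (suc (suc (suc zero))) = p₃

all4? : ∀ {a} {P : Fin 4 → Set a} → (∀ i → Maybe (P i)) → Maybe (∀ i → P i)
all4? f =
  Maybe.ap (Maybe.ap (Maybe.ap (Maybe.map ∀-Fin4 (f (# 0))) (f (# 1))) (f (# 2))) (f (# 3))

≡⇒∣-diff : ∀ {d a b : ℤ} → a ≡ b → d ∣ a - b
≡⇒∣-diff {d} {a} refl = divides (+ 0) (trans (ℤP.+-inverseʳ a) (sym (ℤP.*-zeroˡ d)))

∣-diff-sym : ∀ {d} a b → d ∣ a - b → d ∣ b - a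
∣-diff-sym a b h = subst (_ ∣_) (neg-sub a b) (D.∣m⇒∣-m h)
  where
  neg-sub : ∀ a b → - (a - b) ≡ b - a
  neg-sub = solve-∀

add-back : ∀ a b → a ≡ a - b + b
add-back = solve-∀

sub-sub : ∀ a b → b ≡ a - (a - b)
sub-sub = solve-∀

∣-diff-trans : ∀ {d} a b c → d ∣ a - b → d ∣ b - c → d ∣ a - c
∣-diff-trans a b c h₁ h₂ = subst (_ ∣_) (sym (split a b c)) (D.∣m∣n⇒∣m+n h₁ h₂)
  where
  split : ∀ a b c → a - c ≡ (a - b) + (b - c)
  split = solve-∀

pow-suc : ∀ p n → + (p ^ ℕ.suc n) ≡ + (p ^ n) * + p
pow-suc p n = trans (cong +_ (ℕP.*-comm p (p ^ n))) (ℤP.pos-* (p ^ n) p)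

pow∣pow-suc : ∀ p n → + (p ^ n) ∣ + (p ^ ℕ.suc n)
pow∣pow-suc p n = divides (+ p) (ℤP.pos-* p (p ^ n))

coprime-pow : ∀ {p m} → Coprime p m → ∀ n → Coprime (p ^ n) m
coprime-pow c ℕ.zero    (d∣1 , _)      = ℕD.∣1⇒≡1 d∣1
coprime-pow {p} c (ℕ.suc n) (d∣pⁿ⁺¹ , d∣m) =
  coprime-pow c n (coprime-divisor d-coprime-p d∣pⁿ⁺¹ , d∣m)
  where
  d-coprime-p : Coprime _ p
  d-coprime-p (e∣d , e∣p) = c (e∣p , ℕD.∣-trans e∣d d∣m)

ℕ-identity⇒ℤ : ∀ {a b c d} → 1 ℕ.+ a ℕ.* b ≡ c ℕ.* d → + 1 + + a * + b ≡ + c * + d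
ℕ-identity⇒ℤ {a} {b} {c} {d} eq =
  trans (cong (λ t → + 1 + t) (sym (ℤP.pos-* a b))) (trans (cong +_ eq) (ℤP.pos-* c d))

invertible-mod-ℕ : ∀ {q m} → Coprime q m → ∃ λ v → + q ∣ + m * v - + 1
invertible-mod-ℕ {q} {m} c with coprime-Bézout c
... | Bézout.+- x y eq = - + y , divides (- + x) (begin
  + m * - + y - + 1      ≡⟨ negate (+ m) (+ y) ⟩
  - (+ 1 + + y * + m)    ≡⟨ cong -_ (ℕ-identity⇒ℤ {y} {m} {x} {q} eq) ⟩
  - (+ x * + q)          ≡⟨ ℤP.neg-distribˡ-* (+ x) (+ q) ⟩
  - + x * + q            ∎)
  where
  open ≡-Reasoning
  negate : ∀ m y → m * - y - + 1 ≡ - (+ 1 + y * m)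
  negate = solve-∀
... | Bézout.-+ x y eq = + y , divides (+ x) (begin
  + m * + y - + 1        ≡⟨ cong (_- + 1) (ℤP.*-comm (+ m) (+ y)) ⟩
  + y * + m - + 1        ≡⟨ cong (_- + 1) (sym (ℕ-identity⇒ℤ {x} {q} {y} {m} eq)) ⟩
  + 1 + + x * + q - + 1  ≡⟨ cancel (+ x * + q) ⟩
  + x * + q              ∎)
  where
  open ≡-Reasoning
  cancel : ∀ a → + 1 + a - + 1 ≡ a
  cancel = solve-∀

invertible-mod : ∀ {q} a → Coprime q ℤ.∣ a ∣ → ∃ λ v → + q ∣ a * v - + 1
invertible-mod a c with invertible-mod-ℕ c | ℤP.+∣i∣≡i⊎+∣i∣≡-i a
... | v , h | inj₁ ∣a∣≡a  = v , subst (λ t → _ ∣ t * v - + 1) ∣a∣≡a h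
... | v , h | inj₂ ∣a∣≡-a = - v , subst (_ ∣_) (trans (cong (λ t → t * v - + 1) ∣a∣≡-a) (flip a v)) h
  where
  flip : ∀ a v → - a * v - + 1 ≡ a * - v - + 1
  flip = solve-∀

-- Polynomial identities, decided by normalisation

infix 4 _≈ₙ_ _≟ₙ_

record _≈ₙ_ {k} (s t : Polynomial k) : Set where
  constructor same-normal-form
  field
    normal-forms : normalise s ≈N normalise t

_≟ₙ_ : ∀ {k} (s t : Polynomial k) → Maybe (s ≈ₙ t)
s ≟ₙ t = Maybe.map same-normal-form (normalise s ≟N normalise t)

ℤ-identity : ∀ {k} {s t : Polynomial k} → s ≈ₙ t → ∀ ρ → ⟦ s ⟧ ρ ≡ ⟦ t ⟧ ρ
ℤ-identity {s = s} {t} (same-normal-form s≈t) ρ = prove ρ s t (⟦ s≈t ⟧N-cong ρ)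

-- Bracketed like sum4 in Defs, so that evaluating _·ₚ_ in ℤ_p is _·ₘ_ definitionally.
dotₚ : ∀ {k} → (Fin 4 → Polynomial k) → (Fin 4 → Polynomial k) → Polynomial k
dotₚ a b = a (# 0) :* b (# 0) :+ a (# 1) :* b (# 1) :+ a (# 2) :* b (# 2) :+ a (# 3) :* b (# 3)

PolyMat : ℕ → Set
PolyMat k = Fin 4 → Fin 4 → Polynomial k

infixl 7 _·ₚ_
infixr 8 _•ₚ_
infix  4 _≈ₚ_ _≈ₚ?_

_·ₚ_ : ∀ {k} → PolyMat k → PolyMat k → PolyMat k
(M ·ₚ N) i j = dotₚ (M i) (λ l → N l j)

_•ₚ_ : ∀ {k} → Polynomial k → PolyMat k → PolyMat k
(c •ₚ M) i j = c :* M i j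

transposeₚ : ∀ {k} → PolyMat k → PolyMat k
transposeₚ M i j = M j i

fromRows : ∀ {k} → Vec (Vec (Polynomial k) 4) 4 → PolyMat k
fromRows rows i j = lookup (lookup rows i) j

_≈ₚ_ : ∀ {k} → PolyMat k → PolyMat k → Set
M ≈ₚ N = ∀ i j → M i j ≈ₙ N i j

_≈ₚ?_ : ∀ {k} (M N : PolyMat k) → Maybe (M ≈ₚ N)
M ≈ₚ? N = all4? λ i → all4? λ j → M i j ≟ₙ N i j

0̂ 1̂ -1̂ : ∀ {k} → Polynomial k
0̂  = con (+ 0)
1̂  = con (+ 1)
-1̂ = con (- + 1)

module _ {k : ℕ} where

  idₚ Jₚ : PolyMat k
  idₚ = fromRows ((1̂ ∷ 0̂ ∷ 0̂ ∷ 0̂ ∷ []) ∷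
                  (0̂ ∷ 1̂ ∷ 0̂ ∷ 0̂ ∷ []) ∷
                  (0̂ ∷ 0̂ ∷ 1̂ ∷ 0̂ ∷ []) ∷
                  (0̂ ∷ 0̂ ∷ 0̂ ∷ 1̂ ∷ []) ∷ [])
  Jₚ  = fromRows ((0̂  ∷ 0̂  ∷ 1̂ ∷ 0̂ ∷ []) ∷
                  (0̂  ∷ 0̂  ∷ 0̂ ∷ 1̂ ∷ []) ∷
                  (-1̂ ∷ 0̂  ∷ 0̂ ∷ 0̂ ∷ []) ∷
                  (0̂  ∷ -1̂ ∷ 0̂ ∷ 0̂ ∷ []) ∷ [])

  -- J⁻¹ ᵗC J (as J⁻¹ = ᵗJ): the inverse of a symplectic similitude up to its multiplier.
  adjₚ : PolyMat k → PolyMat k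
  adjₚ C = transposeₚ Jₚ ·ₚ (transposeₚ C ·ₚ Jₚ)

  record IsSimilitudeₚ (C : PolyMat k) (μ : Polynomial k) : Set where
    constructor mkSimilitude
    field
      symplectic    : transposeₚ C ·ₚ (Jₚ ·ₚ C) ≈ₚ μ •ₚ Jₚ
      right-inverse : C ·ₚ adjₚ C ≈ₚ μ •ₚ idₚ
      left-inverse  : adjₚ C ·ₚ C ≈ₚ μ •ₚ idₚ

  similitude? : ∀ C μ → Maybe (IsSimilitudeₚ C μ)
  similitude? C μ =
    Maybe.ap (Maybe.ap (Maybe.map mkSimilitude
      (transposeₚ C ·ₚ (Jₚ ·ₚ C) ≈ₚ? μ •ₚ Jₚ))
      (C ·ₚ adjₚ C ≈ₚ? μ •ₚ idₚ))
      (adjₚ C ·ₚ C ≈ₚ? μ •ₚ idₚ)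

open IsSimilitudeₚ

dot : (Fin 4 → ℤ) → (Fin 4 → ℤ) → ℤ
dot a b = a (# 0) * b (# 0) + a (# 1) * b (# 1) + a (# 2) * b (# 2) + a (# 3) * b (# 3)

minor : (Fin 4 → ℤ) → (Fin 4 → ℤ) → Fin 4 → Fin 4 → ℤ
minor a b k l = a k * b l - a l * b k

sum-over-pairs : (Fin 4 → Fin 4 → ℤ) → ℤ
sum-over-pairs f =
  f (# 0) (# 1) + f (# 0) (# 2) + f (# 0) (# 3) + f (# 1) (# 2) + f (# 1) (# 3) + f (# 2) (# 3)

cauchy-binet₂ : ∀ a b c d →
  dot a c * dot b d - dot a d * dot b c ≡ sum-over-pairs λ k l → minor a b k l * minor c d k l
cauchy-binet₂ a b c d = ℤ-identity identity (tabulate a ++ tabulate b ++ tabulate c ++ tabulate d)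
  where
  aₚ bₚ cₚ dₚ : Fin 4 → Polynomial 16
  aₚ l = var (l ↑ˡ 12)
  bₚ l = var (4 ↑ʳ (l ↑ˡ 8))
  cₚ l = var (8 ↑ʳ (l ↑ˡ 4))
  dₚ l = var (12 ↑ʳ l)
  minorₚ : (Fin 4 → Polynomial 16) → (Fin 4 → Polynomial 16) → Fin 4 → Fin 4 → Polynomial 16
  minorₚ u v k l = u k :* v l :- u l :* v k
  term : Fin 4 → Fin 4 → Polynomial 16
  term k l = minorₚ aₚ bₚ k l :* minorₚ cₚ dₚ k l
  lhs rhs : Polynomial 16
  lhs = dotₚ aₚ cₚ :* dotₚ bₚ dₚ :- dotₚ aₚ dₚ :* dotₚ bₚ cₚ
  rhs = term (# 0) (# 1) :+ term (# 0) (# 2) :+ term (# 0) (# 3) :+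
        term (# 1) (# 2) :+ term (# 1) (# 3) :+ term (# 2) (# 3)
  identity : lhs ≈ₙ rhs
  identity = from-just (lhs ≟ₙ rhs)

module _ {d : ℤ} where

  ∣-dotˡ : ∀ {a} b → (∀ k → d ∣ a k) → d ∣ dot a b
  ∣-dotˡ b d∣a = D.∣m∣n⇒∣m+n (D.∣m∣n⇒∣m+n (D.∣m∣n⇒∣m+n
    (D.∣m⇒∣m*n (b (# 0)) (d∣a (# 0))) (D.∣m⇒∣m*n (b (# 1)) (d∣a (# 1))))
    (D.∣m⇒∣m*n (b (# 2)) (d∣a (# 2)))) (D.∣m⇒∣m*n (b (# 3)) (d∣a (# 3)))

  ∣-dotʳ : ∀ a {b} → (∀ k → d ∣ b k) → d ∣ dot a b
  ∣-dotʳ a d∣b = D.∣m∣n⇒∣m+n (D.∣m∣n⇒∣m+n (D.∣m∣n⇒∣m+n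
    (D.∣n⇒∣m*n (a (# 0)) (d∣b (# 0))) (D.∣n⇒∣m*n (a (# 1)) (d∣b (# 1))))
    (D.∣n⇒∣m*n (a (# 2)) (d∣b (# 2)))) (D.∣n⇒∣m*n (a (# 3)) (d∣b (# 3)))

  minor-∣ : ∀ {a b k₀ k l} → k ≢ l → (∀ m → m ≢ k₀ → d ∣ a m × d ∣ b m) → d ∣ minor a b k l
  minor-∣ {a} {b} {k₀} {k} {l} k≢l supported with k ≟ k₀
  ... | yes refl = D.∣m∣n⇒∣m-n (D.∣n⇒∣m*n (a k) (proj₂ (supported l l≢k)))
                               (D.∣m⇒∣m*n (b k) (proj₁ (supported l l≢k)))
    where
    l≢k : l ≢ k
    l≢k l≡k = k≢l (sym l≡k)
  ... | no k≢k₀ = D.∣m∣n⇒∣m-n (D.∣m⇒∣m*n (b l) (proj₁ (supported k k≢k₀)))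
                              (D.∣n⇒∣m*n (a l) (proj₂ (supported k k≢k₀)))

  ∣-sum-over-pairs : ∀ {f} → (∀ k l → k ≢ l → d ∣ f k l) → d ∣ sum-over-pairs f
  ∣-sum-over-pairs d∣f =
    D.∣m∣n⇒∣m+n (D.∣m∣n⇒∣m+n (D.∣m∣n⇒∣m+n (D.∣m∣n⇒∣m+n (D.∣m∣n⇒∣m+n
    (d∣f (# 0) (# 1) (λ ())) (d∣f (# 0) (# 2) (λ ()))) (d∣f (# 0) (# 3) (λ ())))
    (d∣f (# 1) (# 2) (λ ()))) (d∣f (# 1) (# 3) (λ ()))) (d∣f (# 2) (# 3) (λ ()))

  ∣n∣n-1⇒∣1 : ∀ {a} → d ∣ a → d ∣ a - + 1 → d ∣ + 1
  ∣n∣n-1⇒∣1 {a} d∣a d∣a-1 = subst (d ∣_) (cancel a) (D.∣m∣n⇒∣m-n d∣a d∣a-1)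
    where
    cancel : ∀ a → a - (a - + 1) ≡ + 1
    cancel = solve-∀

  ∣det≡I⇒∣1 : ∀ a b c e → d ∣ a - + 1 → d ∣ b → d ∣ c → d ∣ e - + 1 →
              d ∣ a * e - b * c → d ∣ + 1
  ∣det≡I⇒∣1 a b c e a≡1 b≡0 c≡0 e≡1 d∣det =
    ∣n∣n-1⇒∣1 d∣det (subst (d ∣_) (sym (expand a b c e))
      (D.∣m∣n⇒∣m-n (D.∣m∣n⇒∣m+n (D.∣m⇒∣m*n e a≡1) e≡1) (D.∣m⇒∣m*n c b≡0)))
    where
    expand : ∀ a b c e → a * e - b * c - + 1 ≡ (a - + 1) * e + (e - + 1) - b * c
    expand = solve-∀

module _ {p : ℕ} where

  -- Since _≈_ unfolds to divisibilities of integer differences, Agda cannot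
  -- infer ℤ_p arguments from it; such arguments are given explicitly below.

  ≈-refl : ∀ {x : ℤp p} → x ≈ x
  ≈-refl {x} n = ≡⇒∣-diff {a = seq x n} refl

  ≈-sym : ∀ {x y : ℤp p} → x ≈ y → y ≈ x
  ≈-sym {x} {y} h n = ∣-diff-sym (seq x n) (seq y n) (h n)

  ≈-trans : ∀ {x y z : ℤp p} → x ≈ y → y ≈ z → x ≈ z
  ≈-trans {x} {y} {z} h₁ h₂ n = ∣-diff-trans (seq x n) (seq y n) (seq z n) (h₁ n) (h₂ n)

  ≡⇒≈ : ∀ {x y : ℤp p} → x ≡ y → x ≈ y
  ≡⇒≈ {x} refl = ≈-refl {x}

  ℤp-setoid : Setoid _ _
  ℤp-setoid = record
    { Carrier       = ℤp p
    ; _≈_           = _≈_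
    ; isEquivalence = record
      { refl  = λ {x} → ≈-refl {x}
      ; sym   = λ {x} {y} → ≈-sym {x} {y}
      ; trans = λ {x} {y} {z} → ≈-trans {x} {y} {z}
      }
    }

  module ≈-Reasoning = SetoidReasoning ℤp-setoid

  infixr 8 _^ₚ_

  _^ₚ_ : ℤp p → ℕ → ℤp p
  x ^ₚ ℕ.zero  = 1ₚ
  x ^ₚ ℕ.suc m = x ⊗ x ^ₚ m

  evalₚ : ∀ {k} → Polynomial k → Vec (ℤp p) k → ℤp p
  evalₚ (op [+] s t) xs = evalₚ s xs ⊕ evalₚ t xs
  evalₚ (op [*] s t) xs = evalₚ s xs ⊗ evalₚ t xs
  evalₚ (con c)      xs = ι c
  evalₚ (var i)      xs = lookup xs i
  evalₚ (t :^ m)     xs = evalₚ t xs ^ₚ m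
  evalₚ (:- t)       xs = ⊖ evalₚ t xs

  seq-evalₚ : ∀ {k} (t : Polynomial k) xs n →
              seq (evalₚ t xs) n ≡ ⟦ t ⟧ (Vec.map (λ x → seq x n) xs)
  seq-evalₚ (op [+] s t)   xs n = cong₂ _+_ (seq-evalₚ s xs n) (seq-evalₚ t xs n)
  seq-evalₚ (op [*] s t)   xs n = cong₂ _*_ (seq-evalₚ s xs n) (seq-evalₚ t xs n)
  seq-evalₚ (con c)        xs n = refl
  seq-evalₚ (var i)        xs n = sym (lookup-map i (λ x → seq x n) xs)
  seq-evalₚ (t :^ ℕ.zero)  xs n = refl
  seq-evalₚ (t :^ ℕ.suc m) xs n = cong₂ _*_ (seq-evalₚ t xs n) (seq-evalₚ (t :^ m) xs n)
  seq-evalₚ (:- t)         xs n = cong -_ (seq-evalₚ t xs n)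

  evalₚ-identity : ∀ {k} {s t : Polynomial k} → s ≈ₙ t → ∀ xs → evalₚ s xs ≈ evalₚ t xs
  evalₚ-identity {s = s} {t} s≈t xs n = ≡⇒∣-diff (begin
    seq (evalₚ s xs) n ≡⟨ seq-evalₚ s xs n ⟩
    ⟦ s ⟧ ρ            ≡⟨ ℤ-identity s≈t ρ ⟩
    ⟦ t ⟧ ρ            ≡⟨ seq-evalₚ t xs n ⟨
    seq (evalₚ t xs) n ∎)
    where
    open ≡-Reasoning
    ρ = Vec.map (λ x → seq x n) xs

  evalM : ∀ {k} → PolyMat k → Vec (ℤp p) k → Mat4 {p}
  evalM M xs i j = evalₚ (M i j) xs

  evalM-identity : ∀ {k} {M N : PolyMat k} → M ≈ₚ N → ∀ xs → evalM M xs ≈ₘ evalM N xs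
  evalM-identity M≈N xs i j = evalₚ-identity (M≈N i j) xs

  evalₚ-idₚ : ∀ {k} (xs : Vec (ℤp p) k) i j → evalₚ (idₚ i j) xs ≡ idM i j
  evalₚ-idₚ xs = ∀-Fin4 (∀-Fin4 refl refl refl refl) (∀-Fin4 refl refl refl refl)
                        (∀-Fin4 refl refl refl refl) (∀-Fin4 refl refl refl refl)

  evalₚ-Jₚ : ∀ {k} (xs : Vec (ℤp p) k) i j → evalₚ (Jₚ i j) xs ≡ J i j
  evalₚ-Jₚ xs = ∀-Fin4 (∀-Fin4 refl refl refl refl) (∀-Fin4 refl refl refl refl)
                       (∀-Fin4 refl refl refl refl) (∀-Fin4 refl refl refl refl)

  evalM-scaled-idₚ : ∀ {k} μ (xs : Vec (ℤp p) k) → evalM (μ •ₚ idₚ) xs ≈ₘ evalₚ μ xs •ₘ idM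
  evalM-scaled-idₚ μ xs i j = ≡⇒≈ (cong (evalₚ μ xs ⊗_) (evalₚ-idₚ xs i j))

  evalM-scaled-Jₚ : ∀ {k} μ (xs : Vec (ℤp p) k) → evalM (μ •ₚ Jₚ) xs ≈ₘ evalₚ μ xs •ₘ J
  evalM-scaled-Jₚ μ xs i j = ≡⇒≈ (cong (evalₚ μ xs ⊗_) (evalₚ-Jₚ xs i j))

  units-closed-under-⊗ : ∀ (x y : ℤp p) → IsUnit x → IsUnit y → IsUnit (x ⊗ y)
  units-closed-under-⊗ x y (x′ , xx′≈1) (y′ , yy′≈1) = x′ ⊗ y′ , λ n →
    subst (_ ∣_) (sym (expand (seq x n) (seq y n) (seq x′ n) (seq y′ n)))
      (D.∣m∣n⇒∣m+n (D.∣m⇒∣m*n (seq y n * seq y′ n) (xx′≈1 n)) (yy′≈1 n))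
    where
    expand : ∀ x y x′ y′ → (x * y) * (x′ * y′) - + 1 ≡ (x * x′ - + 1) * (y * y′) + (y * y′ - + 1)
    expand = solve-∀

  -- Inverses modulo pⁿ of the levels of x are automatically coherent.
  unit-of-inverses-mod-pⁿ : ∀ (x : ℤp p) (v : ℕ → ℤ) →
                            (∀ n → + (p ^ n) ∣ seq x n * v n - + 1) → IsUnit x
  unit-of-inverses-mod-pⁿ x v inverse = mkℤp v coherent , inverse
    where
    identity : ∀ x x′ v v′ → v′ - v ≡ (v * v′) * (x - x′) + v * (x′ * v′ - + 1) - v′ * (x * v - + 1)
    identity = solve-∀
    coherent : ∀ n → + (p ^ n) ∣ v (ℕ.suc n) - v n
    coherent n = subst (_ ∣_) (sym (identity (seq x n) (seq x (ℕ.suc n)) (v n) (v (ℕ.suc n))))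
      (D.∣m∣n⇒∣m-n
        (D.∣m∣n⇒∣m+n (D.∣n⇒∣m*n (v n * v (ℕ.suc n)) (∣-diff-sym (seq x (ℕ.suc n)) (seq x n) (coh x n)))
                     (D.∣n⇒∣m*n (v n) (D.∣-trans (pow∣pow-suc p n) (inverse (ℕ.suc n)))))
        (D.∣n⇒∣m*n (v (ℕ.suc n)) (inverse n)))

  scaled-inverse : ∀ (z μ ν δ : ℤp p) → z ≈ μ ⊗ δ → μ ⊗ ν ≈ 1ₚ → ν ⊗ z ≈ δ
  scaled-inverse z μ ν δ z≈μδ μν≈1 n =
    subst (_ ∣_) (sym (identity (seq ν n) (seq z n) (seq μ n) (seq δ n)))
      (D.∣m∣n⇒∣m+n (D.∣n⇒∣m*n (seq ν n) (z≈μδ n)) (D.∣m⇒∣m*n (seq δ n) (μν≈1 n)))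
    where
    identity : ∀ v z m d → v * z - d ≡ v * (z - m * d) + (m * v - + 1) * d
    identity = solve-∀

  invertible-of-scaled-inverse : ∀ {X Y : Mat4 {p}} {μ ν} →
    X ·ₘ Y ≈ₘ μ •ₘ idM → Y ·ₘ X ≈ₘ μ •ₘ idM → μ ⊗ ν ≈ 1ₚ → InGL4 X
  invertible-of-scaled-inverse {X} {Y} {μ} {ν} XY≈μ YX≈μ μν≈1 = ν •ₘ Y , right , left
    where
    scaleʳ : ∀ (x₀ x₁ x₂ x₃ y₀ y₁ y₂ y₃ v : ℤ) →
             x₀ * (v * y₀) + x₁ * (v * y₁) + x₂ * (v * y₂) + x₃ * (v * y₃) ≡
             v * (x₀ * y₀ + x₁ * y₁ + x₂ * y₂ + x₃ * y₃)
    scaleʳ = solve-∀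
    scaleˡ : ∀ (x₀ x₁ x₂ x₃ y₀ y₁ y₂ y₃ v : ℤ) →
             v * y₀ * x₀ + v * y₁ * x₁ + v * y₂ * x₂ + v * y₃ * x₃ ≡
             v * (y₀ * x₀ + y₁ * x₁ + y₂ * x₂ + y₃ * x₃)
    scaleˡ = solve-∀
    right : X ·ₘ (ν •ₘ Y) ≈ₘ idM
    right i j = begin
      (X ·ₘ (ν •ₘ Y)) i j ≈⟨ (λ n → ≡⇒∣-diff (scaleʳ
                               (seq (X i (# 0)) n) (seq (X i (# 1)) n) (seq (X i (# 2)) n) (seq (X i (# 3)) n)
                               (seq (Y (# 0) j) n) (seq (Y (# 1) j) n) (seq (Y (# 2) j) n) (seq (Y (# 3) j) n)
                               (seq ν n))) ⟩
      ν ⊗ (X ·ₘ Y) i j    ≈⟨ scaled-inverse ((X ·ₘ Y) i j) μ ν (idM i j) (XY≈μ i j) μν≈1 ⟩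
      idM i j             ∎
      where open ≈-Reasoning
    left : (ν •ₘ Y) ·ₘ X ≈ₘ idM
    left i j = begin
      ((ν •ₘ Y) ·ₘ X) i j ≈⟨ (λ n → ≡⇒∣-diff (scaleˡ
                               (seq (X (# 0) j) n) (seq (X (# 1) j) n) (seq (X (# 2) j) n) (seq (X (# 3) j) n)
                               (seq (Y i (# 0)) n) (seq (Y i (# 1)) n) (seq (Y i (# 2)) n) (seq (Y i (# 3)) n)
                               (seq ν n))) ⟩
      ν ⊗ (Y ·ₘ X) i j    ≈⟨ scaled-inverse ((Y ·ₘ X) i j) μ ν (idM i j) (YX≈μ i j) μν≈1 ⟩
      idM i j             ∎
      where open ≈-Reasoning

  similitude-in-Γ : ∀ {k} {C : PolyMat k} {μ} → IsSimilitudeₚ C μ →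
                    ∀ xs → IsUnit (evalₚ μ xs) → InΓ (evalM C xs)
  similitude-in-Γ {C = C} {μ} sim xs (ν , μν≈1) =
      invertible-of-scaled-inverse {X = evalM C xs} {evalM (adjₚ C) xs} {evalₚ μ xs} {ν} right left μν≈1
    , evalₚ μ xs , (ν , μν≈1) , symplectic′
    where
    open ≈-Reasoning
    right : evalM C xs ·ₘ evalM (adjₚ C) xs ≈ₘ evalₚ μ xs •ₘ idM
    right i j = begin
      evalM (C ·ₚ adjₚ C) xs i j ≈⟨ evalM-identity (right-inverse sim) xs i j ⟩
      evalM (μ •ₚ idₚ) xs i j    ≈⟨ evalM-scaled-idₚ μ xs i j ⟩
      (evalₚ μ xs •ₘ idM) i j    ∎
    left : evalM (adjₚ C) xs ·ₘ evalM C xs ≈ₘ evalₚ μ xs •ₘ idM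
    left i j = begin
      evalM (adjₚ C ·ₚ C) xs i j ≈⟨ evalM-identity (left-inverse sim) xs i j ⟩
      evalM (μ •ₚ idₚ) xs i j    ≈⟨ evalM-scaled-idₚ μ xs i j ⟩
      (evalₚ μ xs •ₘ idM) i j    ∎
    symplectic′ : transpose (evalM C xs) ·ₘ (J ·ₘ evalM C xs) ≈ₘ evalₚ μ xs •ₘ J
    symplectic′ i j = begin
      evalM (transposeₚ C ·ₚ (Jₚ ·ₚ C)) xs i j ≈⟨ evalM-identity (symplectic sim) xs i j ⟩
      evalM (μ •ₚ Jₚ) xs i j                   ≈⟨ evalM-scaled-Jₚ μ xs i j ⟩
      (evalₚ μ xs •ₘ J) i j                    ∎

  column-of-e : ∀ (X : Mat4 {p}) k i → (X ·ᵥ e k) i ≈ X i k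
  column-of-e X k i =
    ∀-Fin4 {P = λ k → (X ·ᵥ e k) i ≈ X i k}
      (column (# 0)) (column (# 1)) (column (# 2)) (column (# 3)) k
    where
    identity : ∀ k → dotₚ var (λ l → idₚ l k) ≈ₙ var k
    identity = from-just (all4? λ k → dotₚ var (λ l → idₚ l k) ≟ₙ var k)
    column : ∀ k → evalₚ (dotₚ var (λ l → idₚ l k)) (tabulate (X i)) ≈ evalₚ (var k) (tabulate (X i))
    column k = evalₚ-identity (identity k) (tabulate (X i))

  diag-·ᵥ : ∀ a b c d (u : Vec4 {p}) i → (diag a b c d ·ᵥ u) i ≈ diag a b c d i i ⊗ u i
  diag-·ᵥ a b c d u i =
    ∀-Fin4 {P = λ i → (diag a b c d ·ᵥ u) i ≈ diag a b c d i i ⊗ u i}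
      (entry (# 0)) (entry (# 1)) (entry (# 2)) (entry (# 3)) i
    where
    diagₚ : PolyMat 8
    diagₚ = fromRows ((var (# 0) ∷ 0̂ ∷ 0̂ ∷ 0̂ ∷ []) ∷
                      (0̂ ∷ var (# 1) ∷ 0̂ ∷ 0̂ ∷ []) ∷
                      (0̂ ∷ 0̂ ∷ var (# 2) ∷ 0̂ ∷ []) ∷
                      (0̂ ∷ 0̂ ∷ 0̂ ∷ var (# 3) ∷ []) ∷ [])
    uₚ : Fin 4 → Polynomial 8
    uₚ l = var (4 ↑ʳ l)
    identity : ∀ i → dotₚ (diagₚ i) uₚ ≈ₙ diagₚ i i :* uₚ i
    identity = from-just (all4? λ i → dotₚ (diagₚ i) uₚ ≟ₙ diagₚ i i :* uₚ i)
    env : Vec (ℤp p) 8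
    env = (a ∷ b ∷ c ∷ d ∷ []) ++ tabulate u
    entry : ∀ i → evalₚ (dotₚ (diagₚ i) uₚ) env ≈ evalₚ (diagₚ i i :* uₚ i) env
    entry i = evalₚ-identity (identity i) env

  idM-diagonal : ∀ r → idM {p} r r ≡ 1ₚ
  idM-diagonal r with r ≟ r
  ... | yes _   = refl
  ... | no r≢r = ⊥-elim (r≢r refl)

  idM-off-diagonal : ∀ {r s} → r ≢ s → idM {p} r s ≡ 0ₚ
  idM-off-diagonal {r} {s} r≢s with r ≟ s
  ... | yes r≡s = ⊥-elim (r≢s r≡s)
  ... | no _    = refl

  column-entries : ∀ (X : Mat4 {p}) k w → X ·ᵥ e k ≈ᵥ w → ∀ i → X i k ≈ w i
  column-entries X k w Xe≈w i =
    ≈-trans {X i k} {(X ·ᵥ e k) i} {w i} (≈-sym {(X ·ᵥ e k) i} {X i k} (column-of-e X k i)) (Xe≈w i)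

  orbit-of-column : ∀ {H} (X : Mat4 {p}) k w → H X → (∀ i → X i k ≈ w i) → InOrbit H (e k) w
  orbit-of-column X k w HX column =
    X , HX , λ i → ≈-trans {(X ·ᵥ e k) i} {X i k} {w i} (column-of-e X k i) (column i)

  infix 4 _∣ₚ_

  _∣ₚ_ : ℤp p → ℤp p → Set
  d ∣ₚ x = ∃ λ y → d ⊗ y ≈ x

  image-diag : ∀ a b c d (w : Vec4 {p}) → InImage (diag a b c d) w ⇔ (∀ i → diag a b c d i i ∣ₚ w i)
  image-diag a b c d w = mk⇔
    (λ (u , du≈w) i → u i , ≈-trans {diag a b c d i i ⊗ u i} {(diag a b c d ·ᵥ u) i} {w i}
      (≈-sym {(diag a b c d ·ᵥ u) i} {diag a b c d i i ⊗ u i} (diag-·ᵥ a b c d u i)) (du≈w i))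
    (λ d∣w → let u = λ i → proj₁ (d∣w i) in
             u , λ i → ≈-trans {(diag a b c d ·ᵥ u) i} {diag a b c d i i ⊗ u i} {w i}
                               (diag-·ᵥ a b c d u i) (proj₂ (d∣w i)))

  1∣ₚ : ∀ x → 1ₚ ∣ₚ x
  1∣ₚ x = x , λ n → ≡⇒∣-diff {a = + 1 * seq x n} (ℤP.*-identityˡ (seq x n))

  p∣ₚ⇔InPZp : ∀ x → pₚ ∣ₚ x ⇔ InPZp x
  p∣ₚ⇔InPZp x = mk⇔ (λ (y , py≈x) → y , ≈-sym {pₚ ⊗ y} {x} py≈x)
                    (λ (y , x≈py) → y , ≈-sym {x} {pₚ ⊗ y} x≈py)

  InPZp4⇔ : ∀ (w : Vec4 {p}) → InPZp4 w ⇔ (∀ i → InPZp (w i))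
  InPZp4⇔ w = mk⇔ (λ (u , pu≈w) i → u i , ≈-sym {pₚ ⊗ u i} {w i} (pu≈w i))
                  (λ w∈ → (λ i → proj₁ (w∈ i)) ,
                          λ i → ≈-sym {w i} {pₚ ⊗ proj₁ (w∈ i)} (proj₂ (w∈ i)))

  InPZp-resp : ∀ (x y : ℤp p) → x ≈ y → InPZp y → InPZp x
  InPZp-resp x y x≈y (z , y≈pz) = z , ≈-trans {x} {y} {pₚ ⊗ z} x≈y y≈pz

  image-P₁ : ∀ (w : Vec4 {p}) → InImage P₁ w ⇔ InPZp (w (# 2))
  image-P₁ w = mk⇔
    (λ img → to (p∣⇔ (# 2)) (to (image-diag _ _ _ _ w) img (# 2)))
    (λ w₂∈ → from (image-diag _ _ _ _ w)
      (∀-Fin4 (1∣ₚ (w (# 0))) (1∣ₚ (w (# 1))) (from (p∣⇔ (# 2)) w₂∈) (1∣ₚ (w (# 3)))))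
    where p∣⇔ = λ i → p∣ₚ⇔InPZp (w i)

  image-P₃ : ∀ (w : Vec4 {p}) → InImage P₃ w ⇔ (InPZp (w (# 1)) × InPZp (w (# 2)) × InPZp (w (# 3)))
  image-P₃ w = mk⇔
    (λ img → let w∣ = to (image-diag _ _ _ _ w) img in
             to (p∣⇔ (# 1)) (w∣ (# 1)) , to (p∣⇔ (# 2)) (w∣ (# 2)) , to (p∣⇔ (# 3)) (w∣ (# 3)))
    (λ (w₁∈ , w₂∈ , w₃∈) → from (image-diag _ _ _ _ w)
      (∀-Fin4 (1∣ₚ (w (# 0))) (from (p∣⇔ (# 1)) w₁∈)
              (from (p∣⇔ (# 2)) w₂∈) (from (p∣⇔ (# 3)) w₃∈)))
    where p∣⇔ = λ i → p∣ₚ⇔InPZp (w i)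

  image-A : ∀ (w : Vec4 {p}) → InImage A w ⇔ (InPZp (w (# 2)) × InPZp (w (# 3)))
  image-A w = mk⇔
    (λ img → let w∣ = to (image-diag _ _ _ _ w) img in
             to (p∣⇔ (# 2)) (w∣ (# 2)) , to (p∣⇔ (# 3)) (w∣ (# 3)))
    (λ (w₂∈ , w₃∈) → from (image-diag _ _ _ _ w)
      (∀-Fin4 (1∣ₚ (w (# 0))) (1∣ₚ (w (# 1))) (from (p∣⇔ (# 2)) w₂∈) (from (p∣⇔ (# 3)) w₃∈)))
    where p∣⇔ = λ i → p∣ₚ⇔InPZp (w i)

  column-∈pℤp : ∀ (X : Mat4 {p}) k w i → X ·ᵥ e k ≈ᵥ w → InPZp (w i) → InPZp (X i k)
  column-∈pℤp X k w i Xe≈w = InPZp-resp (X i k) (w i) (column-entries X k w Xe≈w i)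

  ∈pℤp-column : ∀ (X : Mat4 {p}) k w i → X ·ᵥ e k ≈ᵥ w → InPZp (X i k) → InPZp (w i)
  ∈pℤp-column X k w i Xe≈w =
    InPZp-resp (w i) (X i k) (≈-sym {X i k} {w i} (column-entries X k w Xe≈w i))

-- Similitudes with a prescribed column

record ColumnSimilitude (k m : Fin 4) : Set where
  field
    matrix     : PolyMat 4
    similitude : IsSimilitudeₚ matrix (var m :* var m)
    column     : ∀ i → matrix i k ≡ var i

open ColumnSimilitude

-- The variables stand for the coordinates of the vector w to be reached.

private
  w₀ w₁ w₂ w₃ : Polynomial 4
  w₀ = var (# 0)
  w₁ = var (# 1)
  w₂ = var (# 2)
  w₃ = var (# 3)

W₂₂ : ColumnSimilitude (# 2) (# 2)
W₂₂ = record { matrix = M ; similitude = from-just (similitude? M (w₂ :* w₂))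
            ; column = ∀-Fin4 refl refl refl refl }
  where
  M : PolyMat 4
  M = fromRows ((w₂ ∷ :- w₃ ∷ w₀ ∷ w₁ ∷ []) ∷
                (0̂  ∷ w₂    ∷ w₁ ∷ 0̂  ∷ []) ∷
                (0̂  ∷ 0̂     ∷ w₂ ∷ 0̂  ∷ []) ∷
                (0̂  ∷ 0̂     ∷ w₃ ∷ w₂ ∷ []) ∷ [])

W₁₁ : ColumnSimilitude (# 1) (# 1)
W₁₁ = record { matrix = M ; similitude = from-just (similitude? M (w₁ :* w₁))
            ; column = ∀-Fin4 refl refl refl refl }
  where
  M : PolyMat 4
  M = fromRows ((w₁ ∷ w₀ ∷ 0̂     ∷ 0̂  ∷ []) ∷
                (0̂  ∷ w₁ ∷ 0̂     ∷ 0̂  ∷ []) ∷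
                (0̂  ∷ w₂ ∷ w₁    ∷ 0̂  ∷ []) ∷
                (w₂ ∷ w₃ ∷ :- w₀ ∷ w₁ ∷ []) ∷ [])

W₁₃ : ColumnSimilitude (# 1) (# 3)
W₁₃ = record { matrix = M ; similitude = from-just (similitude? M (w₃ :* w₃))
            ; column = ∀-Fin4 refl refl refl refl }
  where
  M : PolyMat 4
  M = fromRows ((w₃    ∷ w₀ ∷ 0̂  ∷ 0̂     ∷ []) ∷
                (:- w₂ ∷ w₁ ∷ w₀ ∷ :- w₃ ∷ []) ∷
                (0̂     ∷ w₂ ∷ w₃ ∷ 0̂     ∷ []) ∷
                (0̂     ∷ w₃ ∷ 0̂  ∷ 0̂     ∷ []) ∷ [])

W₀₀ : ColumnSimilitude (# 0) (# 0)
W₀₀ = record { matrix = M ; similitude = from-just (similitude? M (w₀ :* w₀))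
            ; column = ∀-Fin4 refl refl refl refl }
  where
  M : PolyMat 4
  M = fromRows ((w₀ ∷ 0̂  ∷ 0̂  ∷ 0̂     ∷ []) ∷
                (w₁ ∷ w₀ ∷ 0̂  ∷ 0̂     ∷ []) ∷
                (w₂ ∷ w₃ ∷ w₀ ∷ :- w₁ ∷ []) ∷
                (w₃ ∷ 0̂  ∷ 0̂  ∷ w₀    ∷ []) ∷ [])

W₂₃ : ColumnSimilitude (# 2) (# 3)
W₂₃ = record { matrix = M ; similitude = from-just (similitude? M (w₃ :* w₃))
            ; column = ∀-Fin4 refl refl refl refl }
  where
  M : PolyMat 4
  M = fromRows ((0̂  ∷ w₃    ∷ w₀ ∷ 0̂  ∷ []) ∷
                (w₃ ∷ :- w₂ ∷ w₁ ∷ w₀ ∷ []) ∷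
                (0̂  ∷ 0̂     ∷ w₂ ∷ w₃ ∷ []) ∷
                (0̂  ∷ 0̂     ∷ w₃ ∷ 0̂  ∷ []) ∷ [])

W₀₁ : ColumnSimilitude (# 0) (# 1)
W₀₁ = record { matrix = M ; similitude = from-just (similitude? M (w₁ :* w₁))
            ; column = ∀-Fin4 refl refl refl refl }
  where
  M : PolyMat 4
  M = fromRows ((w₀ ∷ w₁ ∷ 0̂  ∷ 0̂     ∷ []) ∷
                (w₁ ∷ 0̂  ∷ 0̂  ∷ 0̂     ∷ []) ∷
                (w₂ ∷ 0̂  ∷ 0̂  ∷ w₁    ∷ []) ∷
                (w₃ ∷ w₂ ∷ w₁ ∷ :- w₀ ∷ []) ∷ [])

-- Reduction modulo a prime p

module Orbits (p : ℕ) (p-prime : Prime p) where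

  private
    P : ℤ
    P = + p

    instance
      p-nonZero : NonZero p
      p-nonZero = prime⇒nonZero p-prime

  residue : ℤp p → ℤ
  residue x = seq x 1

  P∤1 : ¬ P ∣ + 1
  P∤1 P∣1 = ℕP.<⇒≢ (nonTrivial⇒n>1 p {{prime⇒nonTrivial p-prime}})
                   (sym (ℕD.∣1⇒≡1 (D.∣⇒∣ᵤ P∣1)))

  coprime-to-p : ∀ {m} → ¬ p ℕD.∣ m → Coprime p m
  coprime-to-p p∤m (d∣p , d∣m) with prime⇒irreducible p-prime d∣p
  ... | inj₁ d≡1 = d≡1
  ... | inj₂ refl = ⊥-elim (p∤m d∣m)

  ≈⇒residue : ∀ (x y : ℤp p) → x ≈ y → P ∣ residue x - residue y
  ≈⇒residue x y x≈y = subst (λ d → d ∣ residue x - residue y) (cong +_ (ℕP.*-identityʳ p)) (x≈y 1)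

  residue-coh : ∀ (x : ℤp p) n → P ∣ seq x (ℕ.suc n) - residue x
  residue-coh x ℕ.zero    = ≡⇒∣-diff {a = residue x} refl
  residue-coh x (ℕ.suc n) = ∣-diff-trans (seq x (ℕ.suc (ℕ.suc n))) (seq x (ℕ.suc n)) (residue x)
    (D.∣-trans (divides (+ (p ^ n)) (pow-suc p n)) (coh x (ℕ.suc n))) (residue-coh x n)

  InPZp⇒∣ : ∀ (x : ℤp p) → InPZp x → P ∣ residue x
  InPZp⇒∣ x (y , x≈py) = subst (P ∣_) (sym (add-back (residue x) (P * residue y)))
    (D.∣m∣n⇒∣m+n (≈⇒residue x (pₚ ⊗ y) x≈py) (D.∣m⇒∣m*n (residue y) (D.∣-refl {P})))

  ∣⇒InPZp : ∀ (x : ℤp p) → P ∣ residue x → InPZp x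
  ∣⇒InPZp x P∣x₁ = mkℤp q q-coh , x≈pq
    where
    -- q n = seq x (n + 1) / p; the shift of level is what makes q coherent.
    P∣x : ∀ n → P ∣ seq x (ℕ.suc n)
    P∣x n = subst (P ∣_) (sym (add-back (seq x (ℕ.suc n)) (residue x)))
      (D.∣m∣n⇒∣m+n (residue-coh x n) P∣x₁)
    q : ℕ → ℤ
    q n = _∣_.quotient (P∣x n)
    x≡qP : ∀ n → seq x (ℕ.suc n) ≡ q n * P
    x≡qP n = _∣_.equality (P∣x n)
    factor : ∀ a b c → a * c - b * c ≡ (a - b) * c
    factor = solve-∀
    q-coh : ∀ n → + (p ^ n) ∣ q (ℕ.suc n) - q n
    q-coh n = D.*-cancelʳ-∣ P (subst₂ _∣_ (pow-suc p n)
      (trans (cong₂ _-_ (x≡qP (ℕ.suc n)) (x≡qP n)) (factor (q (ℕ.suc n)) (q n) P))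
      (coh x (ℕ.suc n)))
    x≈pq : x ≈ pₚ ⊗ mkℤp q q-coh
    x≈pq n = subst (λ t → + (p ^ n) ∣ seq x n - t) (trans (x≡qP n) (ℤP.*-comm (q n) P))
      (∣-diff-sym (seq x (ℕ.suc n)) (seq x n) (coh x n))

  InPZp? : ∀ x → Dec (InPZp x)
  InPZp? x = map′ (∣⇒InPZp x) (InPZp⇒∣ x) (P ∣? residue x)

  0∈pℤp : InPZp 0ₚ
  0∈pℤp = ∣⇒InPZp 0ₚ (divides (+ 0) refl)

  InPZp-⊖ : ∀ x → InPZp x → InPZp (⊖ x)
  InPZp-⊖ x x∈ = ∣⇒InPZp (⊖ x) (D.∣m⇒∣-m (InPZp⇒∣ x x∈))

  ¬InPZp⇒IsUnit : ∀ (x : ℤp p) → ¬ InPZp x → IsUnit x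
  ¬InPZp⇒IsUnit x x∉ = unit-of-inverses-mod-pⁿ x (λ n → proj₁ (inverse n)) (λ n → proj₂ (inverse n))
    where
    p∤level : ∀ n → ¬ p ℕD.∣ ℤ.∣ seq x (ℕ.suc n) ∣
    p∤level n p∣xₙ = x∉ (∣⇒InPZp x (subst (P ∣_) (sym (sub-sub (seq x (ℕ.suc n)) (residue x)))
      (D.∣m∣n⇒∣m-n (D.∣ᵤ⇒∣ {P} {seq x (ℕ.suc n)} p∣xₙ) (residue-coh x n))))
    coprime : ∀ n → Coprime (p ^ n) ℤ.∣ seq x n ∣
    coprime ℕ.zero    (d∣1 , _) = ℕD.∣1⇒≡1 d∣1
    coprime (ℕ.suc n) = coprime-pow (coprime-to-p (p∤level n)) (ℕ.suc n)
    inverse : ∀ n → ∃ λ v → + (p ^ n) ∣ seq x n * v - + 1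
    inverse n = invertible-mod (seq x n) (coprime n)

  orbit-of-column-similitude : ∀ {H k m} (W : ColumnSimilitude k m) (w : Vec4 {p}) → ¬ InPZp (w m) →
    (InΓ (evalM (matrix W) (tabulate w)) → H (evalM (matrix W) (tabulate w))) → InOrbit H (e k) w
  orbit-of-column-similitude {k = k} {m} W w wₘ∉ H-of-Γ =
    orbit-of-column X k w
      (H-of-Γ (similitude-in-Γ (similitude W) (tabulate w) (units-closed-under-⊗ wₘ wₘ u u)))
      λ i → ≡⇒≈ (trans (cong (λ t → evalₚ t (tabulate w)) (column W i)) (lookup∘tabulate w i))
    where
    X = evalM (matrix W) (tabulate w)
    wₘ = lookup (tabulate w) m
    u = ¬InPZp⇒IsUnit wₘ (subst (¬_ ∘ InPZp) (sym (lookup∘tabulate w m)) wₘ∉)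

  diagonal-residue : ∀ (Z : Mat4 {p}) → Z ≈ₘ idM → ∀ r → P ∣ residue (Z r r) - + 1
  diagonal-residue Z Z≈I r = subst (λ t → P ∣ residue (Z r r) - residue t) (idM-diagonal r)
    (≈⇒residue (Z r r) (idM r r) (Z≈I r r))

  off-diagonal-residue : ∀ (Z : Mat4 {p}) → Z ≈ₘ idM → ∀ {r s} → r ≢ s → P ∣ residue (Z r s)
  off-diagonal-residue Z Z≈I {r} {s} r≢s = subst (P ∣_) (ℤP.+-identityʳ (residue (Z r s)))
    (subst (λ t → P ∣ residue (Z r s) - residue t) (idM-off-diagonal r≢s)
      (≈⇒residue (Z r s) (idM r s) (Z≈I r s)))

  zero-row-not-invertible : ∀ (X Y : Mat4 {p}) r → X ·ₘ Y ≈ₘ idM → ¬ (∀ k → InPZp (X r k))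
  zero-row-not-invertible X Y r XY≈I row∈ = P∤1 (∣n∣n-1⇒∣1
    (∣-dotˡ (λ l → residue (Y l r)) (λ k → InPZp⇒∣ (X r k) (row∈ k)))
    (diagonal-residue (X ·ₘ Y) XY≈I r))

  zero-column-not-invertible : ∀ (X Y : Mat4 {p}) c → Y ·ₘ X ≈ₘ idM → ¬ (∀ k → InPZp (X k c))
  zero-column-not-invertible X Y c YX≈I column∈ = P∤1 (∣n∣n-1⇒∣1
    (∣-dotʳ (λ l → residue (Y c l)) (λ k → InPZp⇒∣ (X k c) (column∈ k)))
    (diagonal-residue (Y ·ₘ X) YX≈I c))

  row-residues column-residues : Mat4 {p} → Fin 4 → Fin 4 → ℤ
  row-residues    X r l = residue (X r l)
  column-residues X c l = residue (X l c)

  minor-products-not-all-divisible : ∀ (X Y : Mat4 {p}) {r s} → X ·ₘ Y ≈ₘ idM → r ≢ s →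
    ¬ (∀ k l → k ≢ l → P ∣ minor (row-residues X r) (row-residues X s) k l *
                           minor (column-residues Y r) (column-residues Y s) k l)
  minor-products-not-all-divisible X Y {r} {s} XY≈I r≢s divisible = P∤1 (∣det≡I⇒∣1
    (dot x y) (dot x y′) (dot x′ y) (dot x′ y′)
    (diagonal-residue (X ·ₘ Y) XY≈I r) (off-diagonal-residue (X ·ₘ Y) XY≈I r≢s)
    (off-diagonal-residue (X ·ₘ Y) XY≈I (r≢s ∘ sym)) (diagonal-residue (X ·ₘ Y) XY≈I s)
    (subst (P ∣_) (sym (cauchy-binet₂ x x′ y y′)) (∣-sum-over-pairs divisible)))
    where
    x x′ y y′ : Fin 4 → ℤ
    x  = row-residues X r
    x′ = row-residues X s
    y  = column-residues Y r
    y′ = column-residues Y s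

  rows-supported-on-a-column : ∀ (X Y : Mat4 {p}) {r s k} → X ·ₘ Y ≈ₘ idM → r ≢ s →
                               ¬ (∀ m → m ≢ k → InPZp (X r m) × InPZp (X s m))
  rows-supported-on-a-column X Y {r} {s} XY≈I r≢s supported =
    minor-products-not-all-divisible X Y XY≈I r≢s λ k l k≢l →
      D.∣m⇒∣m*n (minor (column-residues Y r) (column-residues Y s) k l) (minor-∣ k≢l λ m m≢k →
        InPZp⇒∣ (X r m) (proj₁ (supported m m≢k)) , InPZp⇒∣ (X s m) (proj₂ (supported m m≢k)))

  columns-supported-on-a-row : ∀ (X Y : Mat4 {p}) {r s k} → Y ·ₘ X ≈ₘ idM → r ≢ s →
                               ¬ (∀ m → m ≢ k → InPZp (X m r) × InPZp (X m s))
  columns-supported-on-a-row X Y {r} {s} YX≈I r≢s supported =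
    minor-products-not-all-divisible Y X YX≈I r≢s λ k l k≢l →
      D.∣n⇒∣m*n (minor (row-residues Y r) (row-residues Y s) k l) (minor-∣ k≢l λ m m≢k →
        InPZp⇒∣ (X m r) (proj₁ (supported m m≢k)) , InPZp⇒∣ (X m s) (proj₂ (supported m m≢k)))

  -- Indices are 0-based: e (# 2) is the paper's e₃.

  Γ'-orbit-e₂ : ∀ (w : Vec4 {p}) → InOrbit InΓ' (e (# 2)) w ⇔ (¬ InImage P₁ w)
  Γ'-orbit-e₂ w = mk⇔ necessary sufficient
    where
    necessary : InOrbit InΓ' (e (# 2)) w → ¬ InImage P₁ w
    necessary (X , (((Y , XY≈I , _) , _) , _ , x₂₀ , _ , x₂₁ , x₂₃) , Xe≈w) img =
      zero-row-not-invertible X Y (# 2) XY≈I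
        (∀-Fin4 x₂₀ x₂₁ (column-∈pℤp X (# 2) w (# 2) Xe≈w (to (image-P₁ w) img)) x₂₃)
    sufficient : ¬ InImage P₁ w → InOrbit InΓ' (e (# 2)) w
    sufficient ∉img = case InPZp? (w (# 2)) of λ where
      (yes w₂∈) → ⊥-elim (∉img (from (image-P₁ w) w₂∈))
      (no  w₂∉) → orbit-of-column-similitude W₂₂ w w₂∉
        (_, 0∈pℤp , 0∈pℤp , 0∈pℤp , 0∈pℤp , 0∈pℤp)

  Γ'-orbit-e₁ : ∀ (w : Vec4 {p}) → InOrbit InΓ' (e (# 1)) w ⇔ (InImage P₁ w × ¬ InImage P₃ w)
  Γ'-orbit-e₁ w = mk⇔ necessary sufficient
    where
    necessary : InOrbit InΓ' (e (# 1)) w → InImage P₁ w × ¬ InImage P₃ w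
    necessary (X , (((Y , _ , YX≈I) , _) , x₁₀ , x₂₀ , x₃₀ , x₂₁ , _) , Xe≈w) =
      from (image-P₁ w) (∈pℤp-column X (# 1) w (# 2) Xe≈w x₂₁) , λ img →
        let (w₁∈ , _ , w₃∈) = to (image-P₃ w) img in
        columns-supported-on-a-row X Y {# 0} {# 1} {# 0} YX≈I (λ ()) (∀-Fin4
          (contradiction refl)
          (λ _ → x₁₀ , column-∈pℤp X (# 1) w (# 1) Xe≈w w₁∈)
          (λ _ → x₂₀ , x₂₁)
          (λ _ → x₃₀ , column-∈pℤp X (# 1) w (# 3) Xe≈w w₃∈))
    sufficient : InImage P₁ w × ¬ InImage P₃ w → InOrbit InΓ' (e (# 1)) w
    sufficient (img , ∉img) =
      let w₂∈ = to (image-P₁ w) img in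
      case InPZp? (w (# 1)) ,′ InPZp? (w (# 3)) of λ where
      (no w₁∉ , _) → orbit-of-column-similitude W₁₁ w w₁∉
        (_, 0∈pℤp , 0∈pℤp , w₂∈ , w₂∈ , 0∈pℤp)
      (yes _ , no w₃∉) → orbit-of-column-similitude W₁₃ w w₃∉
        (_, InPZp-⊖ (w (# 2)) w₂∈ , 0∈pℤp , 0∈pℤp , w₂∈ , 0∈pℤp)
      (yes w₁∈ , yes w₃∈) → ⊥-elim (∉img (from (image-P₃ w) (w₁∈ , w₂∈ , w₃∈)))

  Γ'-orbit-e₀ : ∀ (w : Vec4 {p}) → InOrbit InΓ' (e (# 0)) w ⇔ (InImage P₃ w × ¬ InPZp4 w)
  Γ'-orbit-e₀ w = mk⇔ necessary sufficient
    where
    necessary : InOrbit InΓ' (e (# 0)) w → InImage P₃ w × ¬ InPZp4 w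
    necessary (X , (((Y , _ , YX≈I) , _) , x₁₀ , x₂₀ , x₃₀ , _ , _) , Xe≈w) =
        from (image-P₃ w) (w∈ (# 1) x₁₀ , w∈ (# 2) x₂₀ , w∈ (# 3) x₃₀)
      , λ w∈pℤp⁴ → zero-column-not-invertible X Y (# 0) YX≈I (∀-Fin4
          (column-∈pℤp X (# 0) w (# 0) Xe≈w (to (InPZp4⇔ w) w∈pℤp⁴ (# 0))) x₁₀ x₂₀ x₃₀)
      where
      w∈ = λ i → ∈pℤp-column X (# 0) w i Xe≈w
    sufficient : InImage P₃ w × ¬ InPZp4 w → InOrbit InΓ' (e (# 0)) w
    sufficient (img , ∉pℤp⁴) =
      let (w₁∈ , w₂∈ , w₃∈) = to (image-P₃ w) img in
      case InPZp? (w (# 0)) of λ where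
      (yes w₀∈) → ⊥-elim (∉pℤp⁴ (from (InPZp4⇔ w) (∀-Fin4 w₀∈ w₁∈ w₂∈ w₃∈)))
      (no  w₀∉) → orbit-of-column-similitude W₀₀ w w₀∉
        (_, w₁∈ , w₂∈ , w₃∈ , w₃∈ , InPZp-⊖ (w (# 1)) w₁∈)

  ΓA-orbit-e₂ : ∀ (w : Vec4 {p}) → InOrbit InΓA (e (# 2)) w ⇔ (¬ InImage A w)
  ΓA-orbit-e₂ w = mk⇔ necessary sufficient
    where
    necessary : InOrbit InΓA (e (# 2)) w → ¬ InImage A w
    necessary (X , (((Y , XY≈I , _) , _) , x₂₀ , x₂₁ , x₃₀ , x₃₁) , Xe≈w) img =
      let (w₂∈ , w₃∈) = to (image-A w) img in
      rows-supported-on-a-column X Y {# 2} {# 3} {# 3} XY≈I (λ ()) (∀-Fin4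
        (λ _ → x₂₀ , x₃₀)
        (λ _ → x₂₁ , x₃₁)
        (λ _ → column-∈pℤp X (# 2) w (# 2) Xe≈w w₂∈ , column-∈pℤp X (# 2) w (# 3) Xe≈w w₃∈)
        (contradiction refl))
    sufficient : ¬ InImage A w → InOrbit InΓA (e (# 2)) w
    sufficient ∉img = case InPZp? (w (# 2)) ,′ InPZp? (w (# 3)) of λ where
      (no w₂∉ , _) → orbit-of-column-similitude W₂₂ w w₂∉
        (_, 0∈pℤp , 0∈pℤp , 0∈pℤp , 0∈pℤp)
      (yes _ , no w₃∉) → orbit-of-column-similitude W₂₃ w w₃∉
        (_, 0∈pℤp , 0∈pℤp , 0∈pℤp , 0∈pℤp)
      (yes w₂∈ , yes w₃∈) → ⊥-elim (∉img (from (image-A w) (w₂∈ , w₃∈)))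

  ΓA-orbit-e₀ : ∀ (w : Vec4 {p}) → InOrbit InΓA (e (# 0)) w ⇔ (InImage A w × ¬ InPZp4 w)
  ΓA-orbit-e₀ w = mk⇔ necessary sufficient
    where
    necessary : InOrbit InΓA (e (# 0)) w → InImage A w × ¬ InPZp4 w
    necessary (X , (((Y , _ , YX≈I) , _) , x₂₀ , _ , x₃₀ , _) , Xe≈w) =
        from (image-A w) (w∈ (# 2) x₂₀ , w∈ (# 3) x₃₀)
      , λ w∈pℤp⁴ → zero-column-not-invertible X Y (# 0) YX≈I (∀-Fin4
          (column-∈pℤp X (# 0) w (# 0) Xe≈w (to (InPZp4⇔ w) w∈pℤp⁴ (# 0)))
          (column-∈pℤp X (# 0) w (# 1) Xe≈w (to (InPZp4⇔ w) w∈pℤp⁴ (# 1)))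
          x₂₀ x₃₀)
      where
      w∈ = λ i → ∈pℤp-column X (# 0) w i Xe≈w
    sufficient : InImage A w × ¬ InPZp4 w → InOrbit InΓA (e (# 0)) w
    sufficient (img , ∉pℤp⁴) =
      let (w₂∈ , w₃∈) = to (image-A w) img in
      case InPZp? (w (# 0)) ,′ InPZp? (w (# 1)) of λ where
      (no w₀∉ , _) → orbit-of-column-similitude W₀₀ w w₀∉
        (_, w₂∈ , w₃∈ , w₃∈ , 0∈pℤp)
      (yes _ , no w₁∉) → orbit-of-column-similitude W₀₁ w w₁∉
        (_, w₂∈ , 0∈pℤp , w₃∈ , w₂∈)
      (yes w₀∈ , yes w₁∈) → ⊥-elim (∉pℤp⁴ (from (InPZp4⇔ w) (∀-Fin4 w₀∈ w₁∈ w₂∈ w₃∈)))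

lemma5p1 : (p : ℕ) → Prime p →
    (∀ (w : Vec4 {p}) →
       InOrbit InΓ' (e (suc (suc zero))) w ⇔ (¬ InImage P₁ w))
    × (∀ (w : Vec4 {p}) →
       InOrbit InΓ' (e (suc zero)) w ⇔ (InImage P₁ w × ¬ InImage P₃ w))
    × (∀ (w : Vec4 {p}) →
       InOrbit InΓ' (e zero) w ⇔ (InImage P₃ w × ¬ InPZp4 w))
    × (∀ (w : Vec4 {p}) →
       InOrbit InΓA (e (suc (suc zero))) w ⇔ (¬ InImage A w))
    × (∀ (w : Vec4 {p}) →
       InOrbit InΓA (e zero) w ⇔ (InImage A w × ¬ InPZp4 w))
lemma5p1 p p-prime = Γ'-orbit-e₂ , Γ'-orbit-e₁ , Γ'-orbit-e₀ , ΓA-orbit-e₂ , ΓA-orbit-e₀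
  where open Orbits p p-prime
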